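{- Let $W=\langle K,\le,D,J,v\rangle$ be a strict finitistic model. (i) If $W$ has the atomic prevalence property and the total constructibility property, then it has the object prevalence property. (ii) If $W$ has the atomic decidability property and the object prevalence property, then it has the atomic prevalence property.
   Context: Language: $\mathcal{L}$ is a first-order language with $\top,\bot$, connectives $\land,\lor,\to,\neg$ ($\neg$ primitive, distinct from $A\to\bot$), $\forall,\exists$, countably many variables, constants, function and predicate symbols, including a distinguished unary predicate $E$. $\mathcal{L}(D)$ adds constants $\overline d$ for $d\in D$. GN formulas: $N::=\bot\mid\neg A\mid N\land N\mid N\lor N\mid N\to N\mid\forall xN\mid\exists xN$; $\forall xA$/$\exists xA$ is global if $x$ occurs free in $A$ and all its free occurrences lie inside GN subformulas, local otherwise. Strict finitistic model $W=\langle K,\le,D,J,v\rangle$: rooted tree (countable branching, height $\le\omega$), nonempty constant domain $D$, compositional interpretation $J$ of closed $\mathcal{L}(D)$-terms with $J(\overline d)=d$, monotone extensions $P^{v(k)}\subseteq D^n$, strictness (values of all subterms of arguments of an atom true at a node lie in $E$'s extension there), finite verification (finitely many predicates with nonempty extension per node). Forcing: atoms via $v(k)$; $\top$ forced, $\bot$ not; $\land,\lor$ componentwise; $k\models A\to B$ iff every $k'\ge k$ forcing $A$ has some $k''\ge k'$ forcing $B$; $k\models\neg A$ iff no node forces $A$; $k\models\forall xA$ iff for all $d$, $k\models\top\to A[\overline d/x]$ (global) or $k\models E(\overline d)\to A[\overline d/x]$ (local); $k\models\exists xA$ iff for some $d$, $k\models A[\overline d/x]$ (global) or $k\models E(\overline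 d)\land A[\overline d/x]$ (local). An open formula is forced iff its universal closure is. Valid: forced at every node; assertible: forced at some node; prevalent: every node $k$ has some $k'\ge k$ forcing it. Properties of $W$: atomic prevalence — every assertible closed atomic $\mathcal{L}(D)$-formula (including $E(c)$) is prevalent; object prevalence — $E(\overline d)$ is prevalent for every $d\in D$; atomic decidability — $\forall x(P(x)\lor\neg P(x))$ is valid for every atomic $\mathcal{L}(D)$-formula $P(x)$; total constructibility — $\forall x\neg\neg E(x)$ is valid. -}

module Defs where

open import Level using (0ℓ)
open import Data.Nat using (ℕ; zero; suc)
open import Data.Fin using (Fin; zero; suc)
open import Data.Bool using (Bool; true; false; T; not; _∧_; _∨_; if_then_else_)
open import Data.List using (List; []; _++_)
open import Data.List.Membership.Propositional using (_∈_)
open import Data.Vec using (Vec; []; _∷_; lookup)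
open import Data.Product using (Σ; _×_; _,_)
open import Data.Sum using (_⊎_)
open import Data.Unit using (⊤; tt)
open import Data.Empty using (⊥)
open import Relation.Nullary using (¬_)
open import Relation.Binary.PropositionalEquality using (_≡_)

data PredSym : ℕ → Set where
  E   : PredSym 1
  rel : ∀ {n} → ℕ → PredSym n

-- Terms of L(D) with (at most) n free variables (de Bruijn indices):
-- variables, name constants d̄ (d ∈ D), countably many constants of L,
-- and countably many function symbols of each arity suc m.
data Term (D : Set) (n : ℕ) : Set where
  var  : Fin n → Term D n
  name : D → Term D n
  con  : ℕ → Term D n
  app  : ∀ {m} → ℕ → Vec (Term D n) (suc m) → Term D n

-- Formulas of L(D) with (at most) n free variables.  ¬' is primitive.
data Formula (D : Set) (n : ℕ) : Set where
  ⊤' ⊥'          : Formula D n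
  atom           : ∀ {m} → PredSym m → Vec (Term D n) m → Formula D n
  _∧'_ _∨'_ _⇒_ : Formula D n → Formula D n → Formula D n
  ¬'_            : Formula D n → Formula D n
  ∀' ∃'          : Formula D (suc n) → Formula D n

module _ {D : Set} where

  mutual
    occT : ∀ {n} → Fin n → Term D n → Bool
    occT i (var j)    = eqFin i j
    occT i (name _)   = false
    occT i (con _)    = false
    occT i (app _ ts) = occTs i ts

    occTs : ∀ {n m} → Fin n → Vec (Term D n) m → Bool
    occTs i []       = false
    occTs i (t ∷ ts) = occT i t ∨ occTs i ts

    eqFin : ∀ {n} → Fin n → Fin n → Bool
    eqFin zero    zero    = true
    eqFin zero    (suc _) = false
    eqFin (suc _) zero    = false
    eqFin (suc i) (suc j) = eqFin i j

  occ : ∀ {n} → Fin n → Formula D n → Bool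
  occ i ⊤'         = false
  occ i ⊥'         = false
  occ i (atom _ ts) = occTs i ts
  occ i (A ∧' B)   = occ i A ∨ occ i B
  occ i (A ∨' B)   = occ i A ∨ occ i B
  occ i (A ⇒ B)    = occ i A ∨ occ i B
  occ i (¬' A)     = occ i A
  occ i (∀' A)     = occ (suc i) A
  occ i (∃' A)     = occ (suc i) A

  isGN : ∀ {n} → Formula D n → Bool
  isGN ⊤'        = false
  isGN ⊥'        = true
  isGN (atom _ _) = false
  isGN (A ∧' B)  = isGN A ∧ isGN B
  isGN (A ∨' B)  = isGN A ∧ isGN B
  isGN (A ⇒ B)   = isGN A ∧ isGN B
  isGN (¬' A)    = true
  isGN (∀' A)    = isGN A
  isGN (∃' A)    = isGN A

  mutual
    occOut : ∀ {n} → Fin n → Formula D n → Bool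
    occOut i A = not (isGN A) ∧ occOut' i A

    occOut' : ∀ {n} → Fin n → Formula D n → Bool
    occOut' i ⊤'         = false
    occOut' i ⊥'         = false
    occOut' i (atom _ ts) = occTs i ts
    occOut' i (A ∧' B)   = occOut i A ∨ occOut i B
    occOut' i (A ∨' B)   = occOut i A ∨ occOut i B
    occOut' i (A ⇒ B)    = occOut i A ∨ occOut i B
    occOut' i (¬' A)     = false
    occOut' i (∀' A)     = occOut (suc i) A
    occOut' i (∃' A)     = occOut (suc i) A

  -- ∀xA / ∃xA (A the body, x = de Bruijn variable 0) is global iff x occurs
  -- free in A and all its free occurrences lie inside GN subformulas.
  global : ∀ {n} → Formula D (suc n) → Bool
  global A = occ zero A ∧ not (occOut zero A)

module Eval {D : Set} (conI : ℕ → D) (funI : ∀ {m} → ℕ → Vec D (suc m) → D) where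

  mutual
    evalT : ∀ {n} → Vec D n → Term D n → D
    evalT ρ (var i)    = lookup ρ i
    evalT ρ (name d)   = d
    evalT ρ (con c)    = conI c
    evalT ρ (app f ts) = funI f (evalTs ρ ts)

    evalTs : ∀ {n m} → Vec D n → Vec (Term D n) m → Vec D m
    evalTs ρ []       = []
    evalTs ρ (t ∷ ts) = evalT ρ t ∷ evalTs ρ ts

  mutual
    AllSub : (D → Set) → Term D 0 → Set
    AllSub Q t = Q (evalT [] t) × SubArgs Q t

    SubArgs : (D → Set) → Term D 0 → Set
    SubArgs Q (app f ts) = AllSubs Q ts
    SubArgs Q _          = ⊤

    AllSubs : ∀ {m} → (D → Set) → Vec (Term D 0) m → Set
    AllSubs Q []       = ⊤
    AllSubs Q (t ∷ ts) = AllSub Q t × AllSubs Q ts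

-- Rooted trees with countable branching and height ≤ ω, presented as
-- prefix-closed sets of finite sequences of naturals, ordered by prefix.
Node : (List ℕ → Bool) → Set
Node inK = Σ (List ℕ) (λ l → T (inK l))

_≼_ : {inK : List ℕ → Bool} → Node inK → Node inK → Set
(l , _) ≼ (l' , _) = Σ (List ℕ) (λ m → l ++ m ≡ l')

record Model : Set₁ where
  field
    inK          : List ℕ → Bool
    root         : T (inK [])
    prefixClosed : ∀ l m → T (inK (l ++ m)) → T (inK l)
    D            : Set
    d₀           : D
    conI         : ℕ → D
    funI         : ∀ {m} → ℕ → Vec D (suc m) → D
    ext          : Node inK → ∀ {n} → PredSym n → Vec D n → Set
    mono         : ∀ {k k' : Node inK} → k ≼ k' → ∀ {n} (P : PredSym n) (ds : Vec D n) →
                   ext k P ds → ext k' P ds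
    strict       : ∀ (k : Node inK) {n} (P : PredSym n) (ts : Vec (Term D 0) n) →
                   ext k P (Eval.evalTs conI funI [] ts) →
                   Eval.AllSubs conI funI (λ d → ext k E (d ∷ [])) ts
    finVer       : ∀ (k : Node inK) → Σ (List (Σ ℕ PredSym)) λ L →
                   ∀ {n} (P : PredSym n) (ds : Vec D n) → ext k P ds → (n , P) ∈ L

module Forcing (M : Model) where
  open Model M
  open Eval conI funI

  K : Set
  K = Node inK

  Imp : (K → Set) → (K → Set) → K → Set
  Imp P Q k = ∀ (k' : K) → k ≼ k' → P k' → Σ K (λ k'' → (k' ≼ k'') × Q k'')

  Eₖ : K → D → Set
  Eₖ k d = ext k E (d ∷ [])

  -- k ⊩ A ⟨ ρ ⟩ : k forces A[ρ], i.e. A with its free variables replaced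
  -- by the name constants of the elements listed in ρ.
  _⊩_⟨_⟩ : ∀ {n} → K → Formula D n → Vec D n → Set
  k ⊩ ⊤' ⟨ ρ ⟩        = ⊤
  k ⊩ ⊥' ⟨ ρ ⟩        = ⊥
  k ⊩ atom P ts ⟨ ρ ⟩ = ext k P (evalTs ρ ts)
  k ⊩ A ∧' B ⟨ ρ ⟩    = (k ⊩ A ⟨ ρ ⟩) × (k ⊩ B ⟨ ρ ⟩)
  k ⊩ A ∨' B ⟨ ρ ⟩    = (k ⊩ A ⟨ ρ ⟩) ⊎ (k ⊩ B ⟨ ρ ⟩)
  k ⊩ A ⇒ B ⟨ ρ ⟩     = Imp (λ k' → k' ⊩ A ⟨ ρ ⟩) (λ k'' → k'' ⊩ B ⟨ ρ ⟩) k
  k ⊩ ¬' A ⟨ ρ ⟩      = ∀ (k' : K) → ¬ (k' ⊩ A ⟨ ρ ⟩)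
  k ⊩ ∀' A ⟨ ρ ⟩      = if global A
    then (∀ (d : D) → Imp (λ _ → ⊤) (λ k'' → k'' ⊩ A ⟨ d ∷ ρ ⟩) k)
    else (∀ (d : D) → Imp (λ k' → Eₖ k' d) (λ k'' → k'' ⊩ A ⟨ d ∷ ρ ⟩) k)
  k ⊩ ∃' A ⟨ ρ ⟩      = if global A
    then Σ D (λ d → k ⊩ A ⟨ d ∷ ρ ⟩)
    else Σ D (λ d → Eₖ k d × (k ⊩ A ⟨ d ∷ ρ ⟩))

  Valid Assertible Prevalent : Formula D 0 → Set
  Valid A      = ∀ (k : K) → k ⊩ A ⟨ [] ⟩
  Assertible A = Σ K (λ k → k ⊩ A ⟨ [] ⟩)
  Prevalent A  = ∀ (k : K) → Σ K (λ k' → (k ≼ k') × (k' ⊩ A ⟨ [] ⟩))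

  AtomicPrevalence : Set
  AtomicPrevalence = ∀ {n} (P : PredSym n) (ts : Vec (Term D 0) n) →
    Assertible (atom P ts) → Prevalent (atom P ts)

  ObjectPrevalence : Set
  ObjectPrevalence = ∀ (d : D) → Prevalent (atom E (name d ∷ []))

  AtomicDecidability : Set
  AtomicDecidability = ∀ {n} (P : PredSym n) (ts : Vec (Term D 1) n) →
    Valid (∀' (atom P ts ∨' (¬' atom P ts)))

  TotalConstructibility : Set
  TotalConstructibility = Valid (∀' (¬' (¬' atom E (var zero ∷ []))))

{-# OPTIONS --safe #-}
module Submission where

-- (i) Total constructibility makes E(d̄) not-not assertible, classically
-- assertible, hence prevalent by atomic prevalence.  (ii) Above any node,
-- instantiating the decidability of the weakened atom P(t̄) (after moving up
-- to a node where the instance is constructed, in the local case) reaches a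
-- node forcing P(t̄) ∨ ¬P(t̄); the right disjunct is refuted by the node
-- asserting P(t̄), so P(t̄) is prevalent.

open import Defs
open import Level using (0ℓ)
open import Axiom.ExcludedMiddle using (ExcludedMiddle)
open import Axiom.DoubleNegationElimination using (em⇒dne)
open import Data.Bool using (true; false)
open import Data.Nat using (ℕ; suc)
open import Data.Vec using (Vec; []; _∷_)
open import Data.List as List using (_++_)
open import Data.List.Properties using (++-assoc; ++-identityʳ)
open import Data.Product using (Σ; _×_; _,_)
open import Data.Sum using (_⊎_; inj₁; inj₂)
open import Data.Unit using (tt)
open import Data.Empty using (⊥-elim)
open import Relation.Nullary using (¬_)
open import Relation.Binary.PropositionalEquality using (_≡_; refl; sym; cong; cong₂; subst)

module _ {D : Set} where

  mutual
    weaken : Term D 0 → Term D 1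
    weaken (var ())
    weaken (name d)   = name d
    weaken (con c)    = con c
    weaken (app f ts) = app f (weakens ts)

    weakens : ∀ {m} → Vec (Term D 0) m → Vec (Term D 1) m
    weakens []       = []
    weakens (t ∷ ts) = weaken t ∷ weakens ts

module _ {D : Set} (conI : ℕ → D) (funI : ∀ {m} → ℕ → Vec D (suc m) → D) where
  open Eval conI funI

  mutual
    evalT-weaken : (ρ : Vec D 1) (t : Term D 0) → evalT ρ (weaken t) ≡ evalT [] t
    evalT-weaken ρ (var ())
    evalT-weaken ρ (name d)   = refl
    evalT-weaken ρ (con c)    = refl
    evalT-weaken ρ (app f ts) = cong (funI f) (evalTs-weaken ρ ts)

    evalTs-weaken : ∀ {m} (ρ : Vec D 1) (ts : Vec (Term D 0) m) →
                    evalTs ρ (weakens ts) ≡ evalTs [] ts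
    evalTs-weaken ρ []       = refl
    evalTs-weaken ρ (t ∷ ts) = cong₂ _∷_ (evalT-weaken ρ t) (evalTs-weaken ρ ts)

module _ (M : Model) where
  open Model M
  open Eval conI funI
  open Forcing M

  ≼-refl : {k : K} → k ≼ k
  ≼-refl {l , _} = List.[] , ++-identityʳ l

  ≼-trans : {k k′ k″ : K} → k ≼ k′ → k′ ≼ k″ → k ≼ k″
  ≼-trans {l , _} (m , refl) (m′ , refl) = m ++ m′ , sym (++-assoc l m m′)

  Eventually : (K → Set) → K → Set
  Eventually P k = Σ K λ k′ → (k ≼ k′) × P k′

  Eventually-join : ∀ {P : K → Set} {k : K} → Eventually (Eventually P) k → Eventually P k
  Eventually-join {k = k} (k′ , k≼k′ , k″ , k′≼k″ , p) = k″ , ≼-trans {k} {k′} {k″} k≼k′ k′≼k″ , p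

  ∀-instance : ObjectPrevalence → ∀ {n} (A : Formula D (suc n)) {ρ : Vec D n} {k : K} →
               k ⊩ ∀' A ⟨ ρ ⟩ → (d : D) → Eventually (_⊩ A ⟨ d ∷ ρ ⟩) k
  ∀-instance op A {k = k} ∀A d with global A
  ... | true  = ∀A d k (≼-refl {k}) tt
  ... | false =
    let k′ , k≼k′ , Ed = op d k in
    Eventually-join {k = k} (k′ , k≼k′ , ∀A d k′ k≼k′ Ed)

  prevalent-if-assertible-and-decided : ∀ {A : Formula D 0} →
    Prevalent (A ∨' (¬' A)) → Assertible A → Prevalent A
  prevalent-if-assertible-and-decided decided (k₀ , a) k with decided k
  ... | k′ , k≼k′ , inj₁ a′  = k′ , k≼k′ , a′
  ... | k′ , k≼k′ , inj₂ ¬a = ⊥-elim (¬a k₀ a)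

  atom-decided : AtomicDecidability → ObjectPrevalence →
    ∀ {n} (P : PredSym n) (ts : Vec (Term D 0) n) → Prevalent (atom P ts ∨' (¬' atom P ts))
  -- ts′ does not mention the bound variable, so any instance will do; here
  -- the nonemptiness of D is used.
  atom-decided ad op P ts k =
    let k′ , k≼k′ , decision = ∀-instance op (atom P ts′ ∨' (¬' atom P ts′)) {[]} {k} (ad P ts′ k) d₀ in
    k′ , k≼k′ , subst (λ ds → ext k′ P ds ⊎ (∀ k″ → ¬ ext k″ P ds))
                      (evalTs-weaken conI funI (d₀ ∷ []) ts) decision
    where ts′ = weakens ts

  object-¬¬assertible : TotalConstructibility → (d : D) →
    ¬ ¬ Assertible (atom E (name d ∷ []))
  object-¬¬assertible tc d ¬asserted =
    let _ , _ , ¬¬E = tc rootNode d rootNode (≼-refl {rootNode}) tt in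
    ¬¬E rootNode λ k E-d → ¬asserted (k , E-d)
    where
    rootNode : K
    rootNode = List.[] , root

mainTheorem15 : ExcludedMiddle 0ℓ → (M : Model) →
    ((Forcing.AtomicPrevalence M × Forcing.TotalConstructibility M) → Forcing.ObjectPrevalence M)
    × ((Forcing.AtomicDecidability M × Forcing.ObjectPrevalence M) → Forcing.AtomicPrevalence M)
mainTheorem15 em M =
  (λ (ap , tc) d → ap E (name d ∷ []) (em⇒dne em (object-¬¬assertible M tc d))) ,
  (λ (ad , op) P ts → prevalent-if-assertible-and-decided M {atom P ts} (atom-decided M ad op P ts))
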